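{- Let $s$ be the Sierpi\`nski word, i.e., the fixed point starting with $a$ of the substitution on $\{a,b\}$ given by $a\mapsto aba$, $b\mapsto bbb$. Its abelian complexity $a(n)$ satisfies $a(n)=\Theta(n^{\log_3 2})$.
   Context: The Parikh vector of a finite word $w$ over $\{a,b\}$ is $(|w|_a,|w|_b)$, the numbers of occurrences of $a$ and $b$ in $w$. The abelian complexity $a(n)$ of an infinite word is the number of distinct Parikh vectors of its factors (blocks of consecutive letters) of length $n$. -}

module Defs where

open import Data.Nat using (ℕ; zero; suc; _+_; _*_; _^_; _≤_; _<_)
open import Data.List using (List; []; _∷_; _++_; concatMap; length)
open import Data.List.Relation.Unary.Unique.Propositional using (Unique)
open import Data.List.Membership.Propositional using (_∈_)
open import Data.Product using (_×_; _,_; ∃; Σ)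
open import Relation.Binary.PropositionalEquality using (_≡_)

data Letter : Set where
  a b : Letter

σ : Letter → List Letter
σ a = a ∷ b ∷ a ∷ []
σ b = b ∷ b ∷ b ∷ []

σ* : List Letter → List Letter
σ* = concatMap σ

σ^_[a] : ℕ → List Letter
σ^ zero [a] = a ∷ []
σ^ suc k [a] = σ* (σ^ k [a])

-- i-th letter of a finite word (default a beyond its length; never used
-- below since |σ^(i+1)(a)| = 3^(i+1) > i)
nth : List Letter → ℕ → Letter
nth [] _ = a
nth (x ∷ _) zero = x
nth (_ ∷ xs) (suc i) = nth xs i

-- The Sierpiński word s : ℕ → Letter, the fixed point of σ starting with a,
-- i.e. the limit of σ^k(a); its i-th letter (0-indexed) is the i-th letter
-- of the prefix σ^(i+1)(a).
sierpinski : ℕ → Letter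
sierpinski i = nth (σ^ suc i [a]) i

parikhLetter : Letter → ℕ × ℕ
parikhLetter a = 1 , 0
parikhLetter b = 0 , 1

_⊕_ : ℕ × ℕ → ℕ × ℕ → ℕ × ℕ
(x , y) ⊕ (u , v) = (x + u) , (y + v)

parikhFactor : (ℕ → Letter) → ℕ → ℕ → ℕ × ℕ
parikhFactor x i zero = 0 , 0
parikhFactor x i (suc n) = parikhLetter (x i) ⊕ parikhFactor x (suc i) n

IsFactorParikh : (ℕ → Letter) → ℕ → ℕ × ℕ → Set
IsFactorParikh x n p = ∃ λ i → parikhFactor x i n ≡ p

-- "The abelian complexity of x at n equals m": the set of Parikh vectors of
-- length-n factors of x is finite with exactly m elements, witnessed by a
-- duplicate-free list enumerating exactly that set.
AbelianComplexity : (ℕ → Letter) → ℕ → ℕ → Set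
AbelianComplexity x n m =
  Σ (List (ℕ × ℕ)) λ L →
    Unique L
    × (∀ p → p ∈ L → IsFactorParikh x n p)
    × (∀ p → IsFactorParikh x n p → p ∈ L)
    × length L ≡ m

{-# OPTIONS --safe #-}
-- Let P n be the number of a's in the prefix of length n. From s(3q) = s(3q+2) = s(q) and
-- s(3q+1) = b one gets P(3q) = 2 P(q) and P(3q+1) = P(3q+2) = P(q) + P(q+1), so P(3^k) = 2^k.
-- These recurrences, together with the absence of the factor aa, make P subadditive
-- (induction on the number of ternary digits), i.e. no factor of length n has more a's than
-- the prefix. Shifting a window changes its a-count by at most one, and the block
-- b^(3^k) starting at 3^k has none, so every count in [0, P n] occurs: a(n) = P n + 1, and
-- 2^k ≤ P n ≤ 2^(k+1) for 3^k ≤ n < 3^(k+1).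
module Submission where

open import Defs
open import Data.Nat using (ℕ; zero; suc; _+_; _*_; _^_; _≤_; _<_; _∸_; z≤n; s≤s)
open import Data.Nat.Properties
open import Data.Nat.Induction using (<-rec)
open import Data.Nat.Tactic.RingSolver using (solve-∀)
open import Algebra.Properties.CommutativeSemigroup +-commutativeSemigroup using (interchange)
open import Data.Product using (_×_; Σ; ∃; _,_; proj₁; proj₂)
open import Data.List using (List; []; _∷_; _++_; length; map; upTo)
open import Data.List.Properties using (concatMap-++; length-map; length-upTo)
open import Data.List.Membership.Propositional using (_∈_)
open import Data.List.Membership.Propositional.Properties using (∈-map⁺; ∈-map⁻; ∈-upTo⁺; ∈-upTo⁻)
open import Data.List.Relation.Unary.Unique.Propositional.Properties using (map⁺; upTo⁺)
open import Relation.Nullary using (yes; no)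
open import Relation.Binary.PropositionalEquality

s : ℕ → Letter
s = sierpinski

n<3^n : ∀ n → n < 3 ^ n
n<3^n zero = s≤s z≤n
n<3^n (suc n) = ≤-trans (+-mono-≤ (m^n>0 3 n) (n<3^n n)) (+-monoʳ-≤ (3 ^ n) (m≤m+n (3 ^ n) _))

length-σ* : ∀ w → length (σ* w) ≡ length w * 3
length-σ* [] = refl
length-σ* (a ∷ w) = cong (3 +_) (length-σ* w)
length-σ* (b ∷ w) = cong (3 +_) (length-σ* w)

length-σ^[a] : ∀ k → length (σ^ k [a]) ≡ 3 ^ k
length-σ^[a] zero = refl
length-σ^[a] (suc k) = trans (length-σ* (σ^ k [a])) (trans (cong (_* 3) (length-σ^[a] k)) (*-comm (3 ^ k) 3))

σ^[a]-prefix : ∀ k → ∃ λ t → σ^ suc k [a] ≡ σ^ k [a] ++ t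
σ^[a]-prefix zero = b ∷ a ∷ [] , refl
σ^[a]-prefix (suc k) with σ^[a]-prefix k
... | t , eq = σ* t , trans (cong σ* eq) (concatMap-++ σ (σ^ k [a]) t)

nth-++ˡ : ∀ u t {i} → i < length u → nth (u ++ t) i ≡ nth u i
nth-++ˡ (x ∷ u) t {zero} _ = refl
nth-++ˡ (x ∷ u) t {suc i} (s≤s i<u) = nth-++ˡ u t i<u

nth-σ^[a]-stable : ∀ d {k i} → i < 3 ^ k → nth (σ^ (d + k) [a]) i ≡ nth (σ^ k [a]) i
nth-σ^[a]-stable zero _ = refl
nth-σ^[a]-stable (suc d) {k} {i} i<3^k with σ^[a]-prefix (d + k)
... | t , eq = begin
  nth (σ^ suc (d + k) [a]) i    ≡⟨ cong (λ w → nth w i) eq ⟩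
  nth (σ^ (d + k) [a] ++ t) i   ≡⟨ nth-++ˡ (σ^ (d + k) [a]) t i<length ⟩
  nth (σ^ (d + k) [a]) i        ≡⟨ nth-σ^[a]-stable d i<3^k ⟩
  nth (σ^ k [a]) i              ∎
  where
  open ≡-Reasoning
  i<length : i < length (σ^ (d + k) [a])
  i<length = subst (i <_) (sym (length-σ^[a] (d + k))) (<-≤-trans i<3^k (^-monoʳ-≤ 3 (m≤n+m k d)))

sierpinski-nth : ∀ k {i} → i < 3 ^ k → s i ≡ nth (σ^ k [a]) i
sierpinski-nth k {i} i<3^k = begin
  nth (σ^ suc i [a]) i          ≡⟨ nth-σ^[a]-stable k (<-≤-trans (n<3^n i) (^-monoʳ-≤ 3 (n≤1+n i))) ⟨
  nth (σ^ (k + suc i) [a]) i    ≡⟨ cong (λ l → nth (σ^ l [a]) i) (+-comm k (suc i)) ⟩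
  nth (σ^ (suc i + k) [a]) i    ≡⟨ nth-σ^[a]-stable (suc i) i<3^k ⟩
  nth (σ^ k [a]) i              ∎
  where open ≡-Reasoning

nth-σ* : ∀ w {j d} → j < length w → d < 3 → nth (σ* w) (j * 3 + d) ≡ nth (σ (nth w j)) d
nth-σ* (a ∷ w) {zero} _ d<3 = nth-++ˡ (σ a) (σ* w) d<3
nth-σ* (b ∷ w) {zero} _ d<3 = nth-++ˡ (σ b) (σ* w) d<3
nth-σ* (a ∷ w) {suc j} (s≤s j<w) d<3 = nth-σ* w j<w d<3
nth-σ* (b ∷ w) {suc j} (s≤s j<w) d<3 = nth-σ* w j<w d<3

*3+digit<3^suc : ∀ k {j d} → j < 3 ^ k → d < 3 → j * 3 + d < 3 ^ suc k
*3+digit<3^suc k {j} {d} j<3^k d<3 = begin-strict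
  j * 3 + d   <⟨ +-monoʳ-< (j * 3) d<3 ⟩
  j * 3 + 3   ≡⟨ +-comm (j * 3) 3 ⟩
  suc j * 3   ≤⟨ *-monoˡ-≤ 3 j<3^k ⟩
  3 ^ k * 3   ≡⟨ *-comm (3 ^ k) 3 ⟩
  3 ^ suc k   ∎
  where open ≤-Reasoning

sierpinski-σ : ∀ j {d} → d < 3 → s (d + j * 3) ≡ nth (σ (s j)) d
sierpinski-σ j {d} d<3 = begin
  s (d + j * 3)                         ≡⟨ cong s (+-comm d (j * 3)) ⟩
  s (j * 3 + d)                         ≡⟨ sierpinski-nth (suc j) (*3+digit<3^suc j (n<3^n j) d<3) ⟩
  nth (σ* (σ^ j [a])) (j * 3 + d)       ≡⟨ nth-σ* (σ^ j [a]) j<length d<3 ⟩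
  nth (σ (nth (σ^ j [a]) j)) d          ≡⟨ cong (λ x → nth (σ x) d) (sierpinski-nth j (n<3^n j)) ⟨
  nth (σ (s j)) d                       ∎
  where
  open ≡-Reasoning
  j<length : j < length (σ^ j [a])
  j<length = subst (j <_) (sym (length-σ^[a] j)) (n<3^n j)

σ-nth : ∀ x → nth (σ x) 0 ≡ x × nth (σ x) 1 ≡ b × nth (σ x) 2 ≡ x
σ-nth a = refl , refl , refl
σ-nth b = refl , refl , refl

sierpinski-*3 : ∀ q → s (q * 3) ≡ s q
sierpinski-*3 q = trans (sierpinski-σ q (s≤s z≤n)) (proj₁ (σ-nth (s q)))

sierpinski-1+*3 : ∀ q → s (1 + q * 3) ≡ b
sierpinski-1+*3 q = trans (sierpinski-σ q (s≤s (s≤s z≤n))) (proj₁ (proj₂ (σ-nth (s q))))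

sierpinski-2+*3 : ∀ q → s (2 + q * 3) ≡ s q
sierpinski-2+*3 q = trans (sierpinski-σ q ≤-refl) (proj₂ (proj₂ (σ-nth (s q))))

data Mod3View : ℕ → Set where
  _*3   : ∀ q → Mod3View (q * 3)
  1+_*3 : ∀ q → Mod3View (1 + q * 3)
  2+_*3 : ∀ q → Mod3View (2 + q * 3)

mod3 : ∀ n → Mod3View n
mod3 zero = 0 *3
mod3 (suc n) with mod3 n
... | q *3 = 1+ q *3
... | 1+ q *3 = 2+ q *3
... | 2+ q *3 = suc q *3

sierpinski-aa-free : ∀ z → s z ≡ a → s (suc z) ≡ b
sierpinski-aa-free = <-rec (λ z → s z ≡ a → s (suc z) ≡ b) step
  where
  step : ∀ z → (∀ {y} → y < z → s y ≡ a → s (suc y) ≡ b) → s z ≡ a → s (suc z) ≡ b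
  step z rec sz≡a with mod3 z
  ... | q *3 = sierpinski-1+*3 q
  ... | 1+ q *3 with () ← trans (sym sz≡a) (sierpinski-1+*3 q)
  ... | 2+ q *3 = trans (sierpinski-*3 (suc q)) (rec q<z (trans (sym (sierpinski-2+*3 q)) sz≡a))
    where
    q<z : q < 2 + q * 3
    q<z = s≤s (≤-trans (m≤m*n q 3) (n≤1+n (q * 3)))

isA : Letter → ℕ
isA x = proj₁ (parikhLetter x)

isA≤1 : ∀ x → isA x ≤ 1
isA≤1 a = ≤-refl
isA≤1 b = z≤n

aCount : (ℕ → Letter) → ℕ → ℕ → ℕ
aCount x i n = proj₁ (parikhFactor x i n)

parikhFactor≡ : ∀ x i n → parikhFactor x i n ≡ (aCount x i n , n ∸ aCount x i n)
parikhFactor≡ x i n = cong (aCount x i n ,_) (begin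
  proj₂ (parikhFactor x i n)                                              ≡⟨ m+n∸m≡n (aCount x i n) _ ⟨
  aCount x i n + proj₂ (parikhFactor x i n) ∸ aCount x i n                ≡⟨ cong (_∸ aCount x i n) (aCount+bCount i n) ⟩
  n ∸ aCount x i n                                                        ∎)
  where
  open ≡-Reasoning
  aCount+bCount : ∀ i n → aCount x i n + proj₂ (parikhFactor x i n) ≡ n
  aCount+bCount i zero = refl
  aCount+bCount i (suc n) with x i
  ... | a = cong suc (aCount+bCount (suc i) n)
  ... | b = trans (+-suc _ _) (cong suc (aCount+bCount (suc i) n))

aCount-+ : ∀ x i m n → aCount x i (m + n) ≡ aCount x i m + aCount x (i + m) n
aCount-+ x i zero n = cong (λ j → aCount x j n) (sym (+-identityʳ i))
aCount-+ x i (suc m) n = begin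
  isA (x i) + aCount x (suc i) (m + n)                         ≡⟨ cong (isA (x i) +_) (aCount-+ x (suc i) m n) ⟩
  isA (x i) + (aCount x (suc i) m + aCount x (suc i + m) n)    ≡⟨ +-assoc (isA (x i)) _ _ ⟨
  isA (x i) + aCount x (suc i) m + aCount x (suc i + m) n      ≡⟨ cong (λ j → isA (x i) + aCount x (suc i) m + aCount x j n) (+-suc i m) ⟨
  isA (x i) + aCount x (suc i) m + aCount x (i + suc m) n      ∎
  where open ≡-Reasoning

aCount-mono : ∀ x i {m n} → m ≤ n → aCount x i m ≤ aCount x i n
aCount-mono x i {m} {n} m≤n = begin
  aCount x i m                              ≤⟨ m≤m+n _ _ ⟩
  aCount x i m + aCount x (i + m) (n ∸ m)   ≡⟨ aCount-+ x i m (n ∸ m) ⟨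
  aCount x i (m + (n ∸ m))                  ≡⟨ cong (aCount x i) (m+[n∸m]≡n m≤n) ⟩
  aCount x i n                              ∎
  where open ≤-Reasoning

aCount-shift : ∀ x i n → aCount x i n ≤ suc (aCount x (suc i) n)
aCount-shift x i n = ≤-trans (aCount-mono x i (n≤1+n n)) (+-monoˡ-≤ _ (isA≤1 (x i)))

intermediate-value : (f : ℕ → ℕ) → (∀ i → f i ≤ suc (f (suc i))) →
                     ∀ {c} i d → c ≤ f i → f (i + d) ≤ c → ∃ λ j → f j ≡ c
intermediate-value f step {c} i zero c≤fi fi≤c = i , ≤-antisym (subst (λ j → f j ≤ c) (+-identityʳ i) fi≤c) c≤fi
intermediate-value f step {c} i (suc d) c≤fi fi+d≤c with c ≟ f i
... | yes c≡fi = i , sym c≡fi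
... | no c≢fi = intermediate-value f step (suc i) d (≤-pred (≤-trans (≤∧≢⇒< c≤fi c≢fi) (step i)))
                  (subst (λ j → f j ≤ c) (+-suc i d) fi+d≤c)

prefix-max⇒abelianComplexity : ∀ x n {j} → (∀ i → aCount x i n ≤ aCount x 0 n) → aCount x j n ≡ 0 →
                               AbelianComplexity x n (suc (aCount x 0 n))
prefix-max⇒abelianComplexity x n {j} ≤prefix no-a =
  L , map⁺ (cong proj₁) (upTo⁺ (suc M)) , sound , complete , trans (length-map vector (upTo (suc M))) (length-upTo (suc M))
  where
  M : ℕ
  M = aCount x 0 n
  vector : ℕ → ℕ × ℕ
  vector c = c , n ∸ c
  L : List (ℕ × ℕ)
  L = map vector (upTo (suc M))
  sound : ∀ p → p ∈ L → IsFactorParikh x n p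
  sound p p∈L with ∈-map⁻ vector p∈L
  ... | c , c∈ , refl with intermediate-value (λ i → aCount x i n) (λ i → aCount-shift x i n) 0 j
                             (≤-pred (∈-upTo⁻ c∈)) (subst (_≤ c) (sym no-a) z≤n)
  ... | i , i≡c = i , trans (parikhFactor≡ x i n) (cong vector i≡c)
  complete : ∀ p → IsFactorParikh x n p → p ∈ L
  complete p (i , refl) = subst (_∈ L) (sym (parikhFactor≡ x i n)) (∈-map⁺ vector (∈-upTo⁺ (s≤s (≤prefix i))))

P : ℕ → ℕ
P = aCount s 0

P-+ : ∀ m n → P (m + n) ≡ P m + aCount s m n
P-+ = aCount-+ s 0

P-mono : ∀ {m n} → m ≤ n → P m ≤ P n
P-mono = aCount-mono s 0

P-suc : ∀ z → P (suc z) ≡ P z + isA (s z)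
P-suc z = begin
  P (suc z)                  ≡⟨ cong P (+-comm 1 z) ⟩
  P (z + 1)                  ≡⟨ P-+ z 1 ⟩
  P z + (isA (s z) + 0)      ≡⟨ cong (P z +_) (+-identityʳ _) ⟩
  P z + isA (s z)            ∎
  where open ≡-Reasoning

P-suc-a : ∀ z → s z ≡ a → P (suc z) ≡ suc (P z)
P-suc-a z sz≡a = trans (P-suc z) (trans (cong (λ x → P z + isA x) sz≡a) (+-comm (P z) 1))

P-suc-b : ∀ z → s z ≡ b → P (suc z) ≡ P z
P-suc-b z sz≡b = trans (P-suc z) (trans (cong (λ x → P z + isA x) sz≡b) (+-identityʳ (P z)))

P-2+≤ : ∀ z → P (2 + z) ≤ suc (P z)
P-2+≤ z with s z in sz
... | a = ≤-reflexive (trans (P-suc-b (suc z) (sierpinski-aa-free z sz)) (P-suc-a z sz))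
... | b = begin
  P (2 + z)                       ≡⟨ P-suc (suc z) ⟩
  P (suc z) + isA (s (suc z))     ≤⟨ +-monoʳ-≤ (P (suc z)) (isA≤1 (s (suc z))) ⟩
  P (suc z) + 1                   ≡⟨ cong (_+ 1) (P-suc-b z sz) ⟩
  P z + 1                         ≡⟨ +-comm (P z) 1 ⟩
  suc (P z)                       ∎
  where open ≤-Reasoning

P-*3 : ∀ q → P (q * 3) ≡ P q + P q
P-*3 zero = refl
P-*3 (suc q) = begin
  P (3 + q * 3)                                 ≡⟨ P-suc (2 + q * 3) ⟩
  P (2 + q * 3) + isA (s (2 + q * 3))           ≡⟨ cong₂ _+_ (P-suc-b (1 + q * 3) (sierpinski-1+*3 q)) (cong isA (sierpinski-2+*3 q)) ⟩
  P (1 + q * 3) + isA (s q)                     ≡⟨ cong (_+ isA (s q)) (P-suc (q * 3)) ⟩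
  P (q * 3) + isA (s (q * 3)) + isA (s q)       ≡⟨ cong₂ (λ m x → m + isA x + isA (s q)) (P-*3 q) (sierpinski-*3 q) ⟩
  P q + P q + isA (s q) + isA (s q)             ≡⟨ regroup (P q) (isA (s q)) ⟩
  (P q + isA (s q)) + (P q + isA (s q))         ≡⟨ cong₂ _+_ (P-suc q) (P-suc q) ⟨
  P (suc q) + P (suc q)                         ∎
  where
  open ≡-Reasoning
  regroup : ∀ p e → p + p + e + e ≡ (p + e) + (p + e)
  regroup = solve-∀

P-1+*3 : ∀ q → P (1 + q * 3) ≡ P q + P (suc q)
P-1+*3 q = begin
  P (1 + q * 3)                     ≡⟨ P-suc (q * 3) ⟩
  P (q * 3) + isA (s (q * 3))       ≡⟨ cong₂ (λ m x → m + isA x) (P-*3 q) (sierpinski-*3 q) ⟩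
  P q + P q + isA (s q)             ≡⟨ +-assoc (P q) (P q) _ ⟩
  P q + (P q + isA (s q))           ≡⟨ cong (P q +_) (P-suc q) ⟨
  P q + P (suc q)                   ∎
  where open ≡-Reasoning

P-2+*3 : ∀ q → P (2 + q * 3) ≡ P q + P (suc q)
P-2+*3 q = trans (P-suc-b (1 + q * 3) (sierpinski-1+*3 q)) (P-1+*3 q)

P-*3^ : ∀ k z → P (z * 3 ^ k) ≡ P z * 2 ^ k
P-*3^ zero z = trans (cong P (*-identityʳ z)) (sym (*-identityʳ (P z)))
P-*3^ (suc k) z = begin
  P (z * (3 * 3 ^ k))                   ≡⟨ cong P (regroup z (3 ^ k)) ⟩
  P (z * 3 ^ k * 3)                     ≡⟨ P-*3 (z * 3 ^ k) ⟩
  P (z * 3 ^ k) + P (z * 3 ^ k)         ≡⟨ cong₂ _+_ (P-*3^ k z) (P-*3^ k z) ⟩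
  P z * 2 ^ k + P z * 2 ^ k             ≡⟨ double (P z) (2 ^ k) ⟩
  P z * (2 * 2 ^ k)                     ∎
  where
  open ≡-Reasoning
  regroup : ∀ z t → z * (3 * t) ≡ z * t * 3
  regroup = solve-∀
  double : ∀ p t → p * t + p * t ≡ p * (2 * t)
  double = solve-∀

P-3^ : ∀ k → P (3 ^ k) ≡ 2 ^ k
P-3^ k = trans (cong P (sym (*-identityˡ (3 ^ k)))) (trans (P-*3^ k 1) (*-identityˡ (2 ^ k)))

Subadditive-on : ℕ → Set
Subadditive-on N = ∀ {x y} → x ≤ N → y ≤ N → P (x + y) ≤ P x + P y

subadditive-on-1 : Subadditive-on 1
subadditive-on-1 z≤n _ = ≤-refl
subadditive-on-1 (s≤s z≤n) z≤n = ≤-refl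
subadditive-on-1 (s≤s z≤n) (s≤s z≤n) = s≤s z≤n

-- As s(3q+1) = b, P(1 + 3q) = P(2 + 3q): in the subadditivity step both arguments can be
-- rounded up to a number ≡ 0 or 2 (mod 3) without changing P.
data Residue02 (N : ℕ) : ℕ → Set where
  residue0 : ∀ q → q ≤ N → Residue02 N (q * 3)
  residue2 : ∀ q → q < N → Residue02 N (2 + q * 3)

quotient<bound : ∀ r {q N} → suc (r + q * 3) ≤ N * 3 → q < N
quotient<bound r {q} {N} le = *-cancelʳ-< 3 q N (≤-trans (s≤s (m≤n+m (q * 3) r)) le)

round-up : ∀ {N x} → x ≤ N * 3 → ∃ λ y → x ≤ y × P y ≡ P x × Residue02 N y
round-up {N} {x} x≤ with mod3 x
... | q *3 = q * 3 , ≤-refl , refl , residue0 q (*-cancelʳ-≤ q N 3 x≤)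
... | 1+ q *3 = 2 + q * 3 , n≤1+n _ , P-suc-b (1 + q * 3) (sierpinski-1+*3 q) , residue2 q (quotient<bound 0 x≤)
... | 2+ q *3 = 2 + q * 3 , ≤-refl , refl , residue2 q (quotient<bound 1 x≤)

module _ {N : ℕ} (subadditive : Subadditive-on N) where
  open ≤-Reasoning

  private
    carry-bound-b : ∀ {q m} → q < N → m < N → s q ≡ b →
                    P (suc (q + m)) + P (2 + (q + m)) ≤ (P q + P (suc q)) + (P m + P (suc m))
    carry-bound-b {q} {m} q<N m<N sq≡b = begin
      P (suc q + m) + P (2 + (q + m))                 ≡⟨ cong (λ t → P (suc q + m) + P (suc t)) (+-suc q m) ⟨
      P (suc q + m) + P (suc q + suc m)               ≤⟨ +-mono-≤ (subadditive q<N (<⇒≤ m<N)) (subadditive q<N m<N) ⟩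
      (P (suc q) + P m) + (P (suc q) + P (suc m))     ≡⟨ cong (λ t → (t + P m) + (P (suc q) + P (suc m))) (P-suc-b q sq≡b) ⟩
      (P q + P m) + (P (suc q) + P (suc m))           ≡⟨ interchange (P q) (P m) (P (suc q)) (P (suc m)) ⟩
      (P q + P (suc q)) + (P m + P (suc m))           ∎

    -- If s q = b or s m = b the carry is absorbed by a shift of one argument; otherwise
    -- s q = s m = a and, there being no factor aa, both terms are at most P (q + m) + 1.
    carry-bound : ∀ {q m} → q < N → m < N →
                  P (suc (q + m)) + P (2 + (q + m)) ≤ (P q + P (suc q)) + (P m + P (suc m))
    carry-bound {q} {m} q<N m<N with s q in sq | s m in sm
    ... | b | _ = carry-bound-b q<N m<N sq
    ... | a | b = subst₂ _≤_ (cong (λ t → P (suc t) + P (2 + t)) (+-comm m q)) (+-comm (P m + P (suc m)) _)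
                         (carry-bound-b m<N q<N sm)
    ... | a | a = begin
      P (suc (q + m)) + P (2 + (q + m))               ≤⟨ +-mono-≤ (≤-trans (P-mono (n≤1+n (suc (q + m)))) (P-2+≤ (q + m))) (P-2+≤ (q + m)) ⟩
      suc (P (q + m)) + suc (P (q + m))               ≤⟨ +-mono-≤ (s≤s q+m-bound) (s≤s q+m-bound) ⟩
      suc (P q + P m) + suc (P q + P m)               ≡⟨ regroup (P q) (P m) ⟩
      (P q + suc (P q)) + (P m + suc (P m))           ≡⟨ cong₂ (λ u v → (P q + u) + (P m + v)) (P-suc-a q sq) (P-suc-a m sm) ⟨
      (P q + P (suc q)) + (P m + P (suc m))           ∎
      where
      q+m-bound : P (q + m) ≤ P q + P m
      q+m-bound = subadditive (<⇒≤ q<N) (<⇒≤ m<N)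
      regroup : ∀ u v → suc (u + v) + suc (u + v) ≡ (u + suc u) + (v + suc v)
      regroup = solve-∀

  subadditive-residue02 : ∀ {x y} → Residue02 N x → Residue02 N y → P (x + y) ≤ P x + P y
  subadditive-residue02 (residue0 q q≤N) (residue0 m m≤N) = begin
    P (q * 3 + m * 3)                     ≡⟨ cong P (*-distribʳ-+ 3 q m) ⟨
    P ((q + m) * 3)                       ≡⟨ P-*3 (q + m) ⟩
    P (q + m) + P (q + m)                 ≤⟨ +-mono-≤ (subadditive q≤N m≤N) (subadditive q≤N m≤N) ⟩
    (P q + P m) + (P q + P m)             ≡⟨ interchange (P q) (P m) (P q) (P m) ⟩
    (P q + P q) + (P m + P m)             ≡⟨ cong₂ _+_ (P-*3 q) (P-*3 m) ⟨
    P (q * 3) + P (m * 3)                 ∎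
  subadditive-residue02 (residue0 q q≤N) (residue2 m m<N) = begin
    P (q * 3 + (2 + m * 3))               ≡⟨ cong P (regroup q m) ⟩
    P (2 + (q + m) * 3)                   ≡⟨ P-2+*3 (q + m) ⟩
    P (q + m) + P (suc (q + m))           ≡⟨ cong (λ t → P (q + m) + P t) (+-suc q m) ⟨
    P (q + m) + P (q + suc m)             ≤⟨ +-mono-≤ (subadditive q≤N (<⇒≤ m<N)) (subadditive q≤N m<N) ⟩
    (P q + P m) + (P q + P (suc m))       ≡⟨ interchange (P q) (P m) (P q) (P (suc m)) ⟩
    (P q + P q) + (P m + P (suc m))       ≡⟨ cong₂ _+_ (P-*3 q) (P-2+*3 m) ⟨
    P (q * 3) + P (2 + m * 3)             ∎
    where
    regroup : ∀ q m → q * 3 + (2 + m * 3) ≡ 2 + (q + m) * 3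
    regroup = solve-∀
  subadditive-residue02 {x} {y} rx@(residue2 _ _) ry@(residue0 _ _) =
    subst₂ _≤_ (cong P (+-comm y x)) (+-comm (P y) (P x)) (subadditive-residue02 ry rx)
  subadditive-residue02 (residue2 q q<N) (residue2 m m<N) = begin
    P ((2 + q * 3) + (2 + m * 3))         ≡⟨ cong P (regroup q m) ⟩
    P (1 + suc (q + m) * 3)               ≡⟨ P-1+*3 (suc (q + m)) ⟩
    P (suc (q + m)) + P (2 + (q + m))     ≤⟨ carry-bound q<N m<N ⟩
    (P q + P (suc q)) + (P m + P (suc m)) ≡⟨ cong₂ _+_ (P-2+*3 q) (P-2+*3 m) ⟨
    P (2 + q * 3) + P (2 + m * 3)         ∎
    where
    regroup : ∀ q m → (2 + q * 3) + (2 + m * 3) ≡ 1 + suc (q + m) * 3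
    regroup = solve-∀

  subadditive-on-*3 : Subadditive-on (N * 3)
  subadditive-on-*3 {x} {y} x≤ y≤ with round-up x≤ | round-up y≤
  ... | x' , x≤x' , Px'≡Px , rx | y' , y≤y' , Py'≡Py , ry = begin
    P (x + y)       ≤⟨ P-mono (+-mono-≤ x≤x' y≤y') ⟩
    P (x' + y')     ≤⟨ subadditive-residue02 rx ry ⟩
    P x' + P y'     ≡⟨ cong₂ _+_ Px'≡Px Py'≡Py ⟩
    P x + P y       ∎

subadditive-on-3^ : ∀ k → Subadditive-on (3 ^ k)
subadditive-on-3^ zero = subadditive-on-1
subadditive-on-3^ (suc k) = subst Subadditive-on (*-comm (3 ^ k) 3) (subadditive-on-*3 (subadditive-on-3^ k))

P-subadditive : ∀ x y → P (x + y) ≤ P x + P y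
P-subadditive x y = subadditive-on-3^ (x + y) (below (m≤m+n x y)) (below (m≤n+m y x))
  where
  below : ∀ {z} → z ≤ x + y → z ≤ 3 ^ (x + y)
  below z≤ = ≤-trans z≤ (<⇒≤ (n<3^n (x + y)))

aCount≤P : ∀ i n → aCount s i n ≤ P n
aCount≤P i n = +-cancelˡ-≤ (P i) _ _ (subst (_≤ P i + P n) (P-+ i n) (P-subadditive i n))

sierpinski-b-block : ∀ k → aCount s (3 ^ k) (3 ^ k) ≡ 0
sierpinski-b-block k = +-cancelˡ-≡ (P (3 ^ k)) _ _ (begin
  P (3 ^ k) + aCount s (3 ^ k) (3 ^ k)  ≡⟨ P-+ (3 ^ k) (3 ^ k) ⟨
  P (3 ^ k + 3 ^ k)                     ≡⟨ cong (λ t → P (3 ^ k + t)) (+-identityʳ (3 ^ k)) ⟨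
  P (2 * 3 ^ k)                         ≡⟨ P-*3^ k 2 ⟩
  2 ^ k + 0                             ≡⟨ cong (_+ 0) (P-3^ k) ⟨
  P (3 ^ k) + 0                         ∎)
  where open ≡-Reasoning

sierpinski-abelianComplexity : ∀ n → AbelianComplexity s n (suc (P n))
sierpinski-abelianComplexity n = prefix-max⇒abelianComplexity s n (λ i → aCount≤P i n) no-a
  where
  no-a : aCount s (3 ^ n) n ≡ 0
  no-a = n≤0⇒n≡0 (≤-trans (aCount-mono s (3 ^ n) (<⇒≤ (n<3^n n))) (≤-reflexive (sierpinski-b-block n)))

P-between-powers : ∀ k {n} → 3 ^ k ≤ n → n < 3 ^ suc k → 2 ^ k ≤ P n × P n ≤ 2 * 2 ^ k
P-between-powers k lo hi = subst (_≤ _) (P-3^ k) (P-mono lo) , subst (_ ≤_) (P-3^ (suc k)) (P-mono (<⇒≤ hi))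

mainTheorem2 :
    Σ ℕ λ C → Σ ℕ λ N → ∀ n → N ≤ n →
      Σ ℕ λ m → AbelianComplexity sierpinski n m
        × (∀ k → 3 ^ k ≤ n → n < 3 ^ suc k →
             (m ≤ C * 2 ^ k) × (2 ^ k ≤ C * m))
mainTheorem2 = 3 , 0 , λ n _ → suc (P n) , sierpinski-abelianComplexity n , λ k lo hi →
  let (2^k≤Pn , Pn≤2*2^k) = P-between-powers k lo hi
  in +-mono-≤ (m^n>0 2 k) Pn≤2*2^k , ≤-trans 2^k≤Pn (≤-trans (n≤1+n (P n)) (m≤n*m (suc (P n)) 3))
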